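{- Let $H$ be a graph with no isolated vertex and let $\mathcal{P}=\{\mathcal{P}(v):v\in V_H\}$, where $\mathcal{P}(v)$ is a partition of $N_{S_2(H)}(v)$. Suppose there exist a vertex $v\in V_H$, a class $A\in\mathcal{P}(v)$, and two distinct edges or loops $e,f$ of $H$ incident with $v$, at least one of which is not a pendant edge of $H$, such that $A$ contains a vertex of $S_2(H)$ inserted into $e$ and a vertex of $S_2(H)$ inserted into $f$. Then $S_2(H,\mathcal{P})$, and $S_2(H,\mathcal{P},\theta)$ for every function $\theta$ from the leaves of $S_2(H,\mathcal{P})$ to the positive integers, is a DTDP-graph but not a minimal DTDP-graph.
   Context: Graphs may have multiple edges and multiple loops. For a vertex $v$, $N_G(v)$ is the set of vertices adjacent to $v$ (a vertex with a loop is its own neighbour); degree counts loops twice; a leaf is a vertex of degree 1; a pendant edge is a (non-loop) edge incident with a leaf. A set $D$ is dominating if every vertex not in $D$ has a neighbour in $D$; $T$ is total dominating if every vertex (including those in $T$) has a neighbour in $T$. A DT-pair is a pair $(D,T)$ of disjoint vertex sets with $D$ dominating and $T$ total dominating; a graph is a DTDP-graph if it has a DT-pair. A connected graph is a minimal DTDP-graph if it is a DTDP-graph and no proper spanning subgraph (same vertex set, proper subset of edges and loops) is a DTDP-graph. 2-subdivision graphs: $S_2(H)$ is obtained from $H$ by inserting two new vertices into each edge and loop: for an edge $e$ with ends $u\ne v$ add vertices $u_e,v_e$ and edges $uu_e,u_ev_e,v_ev$; for a loop $e$ at $v$ add $v_e^1,v_e^2$ and edges $vv_e^1,v_e^1v_e^2,v_e^2v$.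 For $v\in V_H$, $N_{S_2(H)}(v)$ is the set of new vertices adjacent to $v$. Given partitions $\mathcal{P}(v)$ of $N_{S_2(H)}(v)$, $S_2(H,\mathcal{P})$ has vertex set $V_H\cup\{(v,A): v\in V_H, A\in\mathcal{P}(v)\}$; each $v$ is joined by one edge to each $(v,A)$; each edge $e$ of $H$ with ends $u\neq v$ gives one edge joining $(u,B)$ and $(v,A)$ where $u_e\in B$, $v_e\in A$; each loop $e$ at $v$ gives one edge joining $(v,A)$ and $(v,A')$ where $v_e^1\in A$, $v_e^2\in A'$ (a loop if $A=A'$). (Equivalently, identify the vertices of each class $A$ into one vertex $(v,A)$.) For $\theta$ a positive-integer function on the leaves of $S_2(H,\mathcal{P})$, $S_2(H,\mathcal{P},\theta)$ is obtained by replacing each leaf $x$ by $\theta(x)$ leaves adjacent to the neighbour of $x$. -}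

module Defs where

open import Data.Nat using (ℕ; zero; suc; _≤_)
open import Data.Fin using (Fin; toℕ)
open import Data.Bool using (Bool; true; false; T)
open import Data.Product using (Σ; ∃; _×_; _,_; proj₁; proj₂)
open import Data.Sum using (_⊎_; inj₁; inj₂)
open import Data.Empty using (⊥)
open import Data.Irrelevant using (Irrelevant)
open import Function.Bundles using (_↔_)
open import Relation.Nullary using (¬_)
open import Relation.Binary.PropositionalEquality using (_≡_)
open import Relation.Binary.Construct.Closure.ReflexiveTransitive using (Star)

record Graph : Set₁ where
  constructor mkGraph
  field
    V    : Set
    E    : Set
    ends : E → V × V

open Graph public

module _ (G : Graph) where

  end : E G → Bool → V G
  end e false = proj₁ (ends G e)
  end e true  = proj₂ (ends G e)

  IsLoop : E G → Set
  IsLoop e = proj₁ (ends G e) ≡ proj₂ (ends G e)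

  Incident : E G → V G → Set
  Incident e x = Σ Bool λ s → end e s ≡ x

  -- edge-ends at x; a loop at x contributes two of them
  EdgeEnd : V G → Set
  EdgeEnd x = Σ (E G) λ e → Σ Bool λ s → end e s ≡ x

  HasDegree : V G → ℕ → Set
  HasDegree x d = EdgeEnd x ↔ Fin d

  Isolated : V G → Set
  Isolated x = HasDegree x 0

  Leaf : V G → Set
  Leaf x = HasDegree x 1

  Pendant : E G → Set
  Pendant e = ¬ IsLoop e × (Σ (V G) λ x → Incident e x × Leaf x)

  Adj : V G → V G → Set
  Adj x y = Σ (E G) λ e → (ends G e ≡ (x , y)) ⊎ (ends G e ≡ (y , x))

  Dominating : (V G → Set) → Set
  Dominating D = ∀ x → ¬ D x → Σ (V G) λ y → D y × Adj x y

  TotalDominating : (V G → Set) → Set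
  TotalDominating T = ∀ x → Σ (V G) λ y → T y × Adj x y

  IsDTPair : (V G → Set) → (V G → Set) → Set
  IsDTPair D T = (∀ x → D x → T x → ⊥) × Dominating D × TotalDominating T

  IsDTDP : Set₁
  IsDTDP = Σ (V G → Set) λ D → Σ (V G → Set) λ T → IsDTPair D T

  Connected : Set
  Connected = ∀ x y → Star Adj x y

spanning : (G : Graph) → (E G → Bool) → Graph
spanning G keep = mkGraph (V G) (Σ (E G) λ e → T (keep e)) (λ p → ends G (proj₁ p))

IsMinimalDTDP : Graph → Set₁
IsMinimalDTDP G =
  Connected G × IsDTDP G ×
  ((keep : E G → Bool) → (Σ (E G) λ e → keep e ≡ false) → ¬ IsDTDP (spanning G keep))

FinGraph : (n m : ℕ) → (Fin m → Fin n × Fin n) → Graph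
FinGraph n m ends = mkGraph (Fin n) (Fin m) ends

-- Family of partitions P = {P(v)}: all classes of all P(v) are indexed by
-- Fin K; own c is the vertex v with c ∈ P(v); cls e s is the class of the
-- subdivision vertex inserted into e next to its end on side s
-- (side false: u_e resp. v_e^1; side true: v_e resp. v_e^2).
record IsPartitionFamily {n m : ℕ} (ends : Fin m → Fin n × Fin n) (K : ℕ)
         (own : Fin K → Fin n) (cls : Fin m → Bool → Fin K) : Set where
  field
    cls-own  : ∀ e s → own (cls e s) ≡ end (FinGraph n m ends) e s
    cls-onto : ∀ c → Σ (Fin m) λ e → Σ Bool λ s → cls e s ≡ c

-- S₂(H,P): vertices V_H ⊎ classes; edges: one spoke v—(v,A) per class,
-- and one edge (u,B)—(v,A) per edge/loop of H.
S₂P : (n m : ℕ) → (Fin m → Fin n × Fin n) → (K : ℕ) →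
      (Fin K → Fin n) → (Fin m → Bool → Fin K) → Graph
S₂P n m ends K own cls = mkGraph (Fin n ⊎ Fin K) (Fin K ⊎ Fin m) ends′
  where
  ends′ : Fin K ⊎ Fin m → (Fin n ⊎ Fin K) × (Fin n ⊎ Fin K)
  ends′ (inj₁ c) = inj₁ (own c) , inj₂ c
  ends′ (inj₂ e) = inj₂ (cls e false) , inj₂ (cls e true)

-- θ-expansion.  θ is given on all vertices (positive); only its values on
-- leaves matter: a leaf x gets θ x copies, any other vertex exactly one
-- copy (index 0).  Each edge between x and y is copied once for every pair
-- of copies, so a pendant edge at leaf x becomes θ x pendant edges.
Copies : (G : Graph) → (V G → ℕ) → V G → Set
Copies G θ x = Σ (Fin (θ x)) λ i → Irrelevant ((toℕ i ≡ 0) ⊎ Leaf G x)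

expand : (G : Graph) → (V G → ℕ) → Graph
expand G θ = mkGraph (Σ (V G) (Copies G θ))
                     (Σ (E G) λ e → Copies G θ (proj₁ (ends G e)) × Copies G θ (proj₂ (ends G e)))
                     (λ { (e , i , j) → (proj₁ (ends G e) , i) , (proj₂ (ends G e) , j) })

-- Let e be the non-pendant edge, s its side whose subdivision vertex lies in the class A shared
-- with f, and B the class of the subdivision vertex on the other side of e.  If B meets an edge
-- other than e, delete the middle edge of e: (V_H, all classes) is still a DT-pair, since every
-- class keeps a neighbouring class through an edge other than e (for A this is f).  Otherwise B
-- consists of that single subdivision vertex, and we delete the spoke at B: (V_H ∪ {B}, the other
-- classes) is a DT-pair, since B still sees A along e, and the vertex of H at B has a second
-- edge-end because e is not pendant.  Either way a proper spanning subgraph is DTDP, and this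
-- lifts to every θ-expansion by sending each vertex to its first copy.
module Submission where

open import Defs
open import Data.Nat using (ℕ; _≤_; suc)
open import Data.Fin using (Fin) renaming (zero to fzero; suc to fsuc)
open import Data.Fin.Properties using (any?) renaming (_≟_ to _≟ᶠ_)
open import Data.Bool using (Bool; true; false; T; not)
open import Data.Bool.Properties using (¬-not; not-¬; not-injective) renaming (_≟_ to _≟ᵇ_)
open import Data.Product using (Σ; _×_; _,_; proj₁; proj₂; map₂)
open import Data.Sum using (_⊎_; inj₁; inj₂; [_,_])
open import Data.Sum.Properties using (inj₁-injective; inj₂-injective) renaming (≡-dec to ⊎-≡-dec)
open import Data.Unit using (⊤; tt)
open import Data.Empty using (⊥; ⊥-elim)
open import Data.Irrelevant using () renaming ([_] to irrelevant)
open import Function using (_∘_; id)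
open import Function.Bundles using (mk↔ₛ′)
open import Relation.Binary.Definitions using (DecidableEquality)
open import Relation.Nullary using (¬_; Dec; yes; no)
open import Relation.Nullary.Decidable using (_×-dec_; _⊎-dec_; ¬?; ⌊_⌋; map′; decidable-stable)
open import Relation.Binary.PropositionalEquality using (_≡_; _≢_; refl; sym; trans; cong; subst)
open import Axiom.UniquenessOfIdentityProofs using (module Decidable⇒UIP)

ProperSpanningDTDP : Graph → Set₁
ProperSpanningDTDP G =
  Σ (E G → Bool) λ keep → (Σ (E G) λ e → keep e ≡ false) × IsDTDP (spanning G keep)

Adj-sym : ∀ {G x y} → Adj G x y → Adj G y x
Adj-sym (e , inj₁ p) = e , inj₂ p
Adj-sym (e , inj₂ p) = e , inj₁ p

IsDTDP-pullback : ∀ {G G′} (φ : V G′ → V G) (ψ : V G → V G′) → (∀ y → φ (ψ y) ≡ y) →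
                  (∀ {x′ y} → Adj G (φ x′) y → Adj G′ x′ (ψ y)) → IsDTDP G → IsDTDP G′
IsDTDP-pullback φ ψ φψ lift (D , T′ , disjoint , dominating , total) =
  D ∘ φ , T′ ∘ φ , disjoint ∘ φ ,
  (λ x′ x′∉D → let (y , y∈D , x~y) = dominating (φ x′) x′∉D
               in ψ y , subst D (sym (φψ y)) y∈D , lift x~y) ,
  (λ x′ → let (y , y∈T , x~y) = total (φ x′)
          in ψ y , subst T′ (sym (φψ y)) y∈T , lift x~y)

module _ {G : Graph} where

  spanning-Adj : ∀ {keep x y} → Adj (spanning G keep) x y → Adj G x y
  spanning-Adj ((e , _) , p) = e , p

  ProperSpanningDTDP⇒nonMinimalDTDP : ProperSpanningDTDP G → IsDTDP G × ¬ IsMinimalDTDP G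
  ProperSpanningDTDP⇒nonMinimalDTDP (keep , deleted , dtdp) =
    IsDTDP-pullback id id (λ _ → refl) spanning-Adj dtdp ,
    λ (_ , _ , minimal) → minimal keep deleted dtdp

module _ {G : Graph} {θ : V G → ℕ} (θ-pos : ∀ x → 1 ≤ θ x) where

  copy₀ : ∀ x → Copies G θ x
  copy₀ x with θ x | θ-pos x
  ... | suc _ | _ = fzero , irrelevant (inj₁ refl)

  private
    copies-along : ∀ {x y} (p : V G × V G) → p ≡ (x , y) →
                   (i : Copies G θ x) (j : Copies G θ y) →
                   Σ (Copies G θ (proj₁ p) × Copies G θ (proj₂ p)) λ ij →
                     ((proj₁ p , proj₁ ij) , (proj₂ p , proj₂ ij)) ≡ ((x , i) , (y , j))
    copies-along _ refl i j = (i , j) , refl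

    expand-edge-Adj : ∀ {keep x y} (e : E G) → T (keep e) → ends G e ≡ (x , y) →
                      (i : Copies G θ x) (j : Copies G θ y) →
                      Adj (spanning (expand G θ) (keep ∘ proj₁)) (x , i) (y , j)
    expand-edge-Adj e kept p i j =
      let ((i′ , j′) , q) = copies-along (ends G e) p i j in ((e , i′ , j′) , kept) , inj₁ q

  expand-Adj : ∀ {keep x y} → Adj (spanning G keep) x y → (i : Copies G θ x) →
               Adj (spanning (expand G θ) (keep ∘ proj₁)) (x , i) (y , copy₀ y)
  expand-Adj ((e , kept) , inj₁ p) i = expand-edge-Adj e kept p i (copy₀ _)
  expand-Adj ((e , kept) , inj₂ p) i = Adj-sym (expand-edge-Adj e kept p (copy₀ _) i)

  expand-ProperSpanningDTDP : ProperSpanningDTDP G → ProperSpanningDTDP (expand G θ)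
  expand-ProperSpanningDTDP (keep , (e , e-deleted) , dtdp) =
    keep ∘ proj₁ ,
    ((e , copy₀ _ , copy₀ _) , e-deleted) ,
    IsDTDP-pullback proj₁ (λ y → y , copy₀ y) (λ _ → refl) (λ { {_ , i} x~y → expand-Adj x~y i }) dtdp

module EdgeDeletion (G : Graph) (_≟_ : DecidableEquality (E G)) (r : E G) where

  keepAllBut : E G → Bool
  keepAllBut x = not ⌊ x ≟ r ⌋

  deleted : Graph
  deleted = spanning G keepAllBut

  kept : ∀ {x} → x ≢ r → T (keepAllBut x)
  kept {x} x≢r with x ≟ r
  ... | yes x≡r = ⊥-elim (x≢r x≡r)
  ... | no _    = tt

  deleted-Adj : ∀ {x y} (e : E G) → e ≢ r → ends G e ≡ (x , y) → Adj deleted x y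
  deleted-Adj e e≢r p = (e , kept e≢r) , inj₁ p

  IsDTDP-deleted⇒ProperSpanningDTDP : IsDTDP deleted → ProperSpanningDTDP G
  IsDTDP-deleted⇒ProperSpanningDTDP dtdp = keepAllBut , (r , r-deleted) , dtdp
    where
    r-deleted : keepAllBut r ≡ false
    r-deleted with r ≟ r
    ... | yes _   = refl
    ... | no r≢r = ⊥-elim (r≢r refl)

anyEnd? : ∀ {m} {P : Fin m → Bool → Set} → (∀ e s → Dec (P e s)) → Dec (Σ (Fin m) λ e → Σ Bool (P e))
anyEnd? P? = any? λ e →
  map′ (λ { (inj₁ p) → false , p ; (inj₂ p) → true , p })
       (λ { (false , p) → inj₁ p ; (true , p) → inj₂ p })
       (P? e false ⊎-dec P? e true)

module _ {n m : ℕ} {ends : Fin m → Fin n × Fin n} where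

  private
    H : Graph
    H = FinGraph n m ends

  ¬Isolated⇒EdgeEnd : ∀ {w} → ¬ Isolated H w → EdgeEnd H w
  ¬Isolated⇒EdgeEnd {w} not-isolated with anyEnd? (λ e s → end H e s ≟ᶠ w)
  ... | yes edgeEnd = edgeEnd
  ... | no none = ⊥-elim (not-isolated (mk↔ₛ′ (⊥-elim ∘ none) (λ ()) (λ ()) (⊥-elim ∘ none)))

  sole-EdgeEnd⇒Leaf : ∀ {e s} → (∀ e′ s′ → end H e′ s′ ≡ end H e s → e′ ≡ e × s′ ≡ s) →
                      Leaf H (end H e s)
  sole-EdgeEnd⇒Leaf {e} {s} sole =
    mk↔ₛ′ (λ _ → fzero) (λ _ → e , s , refl) (λ { fzero → refl ; (fsuc ()) }) unique
    where
    unique : ∀ x → (e , s , refl) ≡ x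
    unique (e′ , s′ , p) with sole e′ s′ p
    ... | refl , refl = cong (λ q → e , s , q) (Decidable⇒UIP.≡-irrelevant _≟ᶠ_ refl p)

  ¬Pendant⇒anotherEdgeEnd : ∀ {e} → ¬ Pendant H e → ∀ s →
    Σ (Fin m) λ e′ → Σ Bool λ s′ → end H e′ s′ ≡ end H e s × ¬ (e′ ≡ e × s′ ≡ s)
  ¬Pendant⇒anotherEdgeEnd {e} not-pendant s
    with anyEnd? (λ e′ s′ → (end H e′ s′ ≟ᶠ end H e s) ×-dec ¬? ((e′ ≟ᶠ e) ×-dec (s′ ≟ᵇ s)))
  ... | yes another = another
  ... | no none = ⊥-elim (not-pendant (not-loop , end H e s , (s , refl) , sole-EdgeEnd⇒Leaf sole))
    where
    sole : ∀ e′ s′ → end H e′ s′ ≡ end H e s → e′ ≡ e × s′ ≡ s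
    sole e′ s′ p with (e′ ≟ᶠ e) ×-dec (s′ ≟ᵇ s)
    ... | yes same     = same
    ... | no different = ⊥-elim (none (e′ , s′ , p , different))

    swap : IsLoop H e → ∀ s → end H e (not s) ≡ end H e s
    swap loop false = sym loop
    swap loop true  = loop

    not-loop : ¬ IsLoop H e
    not-loop loop = not-¬ refl (sym (proj₂ (sole e (not s) (swap loop s))))

module S₂P-NonMinimal {n m : ℕ} {ends : Fin m → Fin n × Fin n}
  (no-isolated : ∀ v → ¬ Isolated (FinGraph n m ends) v)
  {K : ℕ} {own : Fin K → Fin n} {cls : Fin m → Bool → Fin K}
  (partition : IsPartitionFamily ends K own cls) where

  open IsPartitionFamily partition

  private
    H : Graph
    H = FinGraph n m ends

    G : Graph
    G = S₂P n m ends K own cls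

    _≟ₑ_ : DecidableEquality (E G)
    _≟ₑ_ = ⊎-≡-dec _≟ᶠ_ _≟ᶠ_

    module Without (r : E G) where
      open EdgeDeletion G _≟ₑ_ r public

      spoke-Adj : ∀ {c w} → own c ≡ w → inj₁ c ≢ r → Adj deleted (inj₁ w) (inj₂ c)
      spoke-Adj {c} refl c≢r = deleted-Adj (inj₁ c) c≢r refl

      subdivided-Adj : ∀ {e} → inj₂ e ≢ r → ∀ s →
                       Adj deleted (inj₂ (cls e s)) (inj₂ (cls e (not s)))
      subdivided-Adj e≢r false = deleted-Adj _ e≢r refl
      subdivided-Adj e≢r true  = Adj-sym (deleted-Adj _ e≢r refl)

  module _ {e f : Fin m} {s t : Bool} (e≢f : e ≢ f) (e-not-pendant : ¬ Pendant H e)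
           (same-class : cls f t ≡ cls e s) where

    private
      A B : Fin K
      A = cls e s
      B = cls e (not s)

    IsDTDP-without-middle-edge : (Σ (Fin m) λ e′ → Σ Bool λ s′ → cls e′ s′ ≡ B × e′ ≢ e) →
                                 IsDTDP (Without.deleted (inj₂ e))
    IsDTDP-without-middle-edge (e′ , s′ , e′∈B , e′≢e) = D , T′ , disjoint , dominating , total
      where
      open Without (inj₂ e)

      D T′ : V G → Set
      D = [ (λ _ → ⊤) , (λ _ → ⊥) ]
      T′ = [ (λ _ → ⊥) , (λ _ → ⊤) ]

      disjoint : ∀ x → D x → T′ x → ⊥
      disjoint (inj₁ _) _ ()

      dominating : Dominating deleted D
      dominating (inj₁ _) w∉D = ⊥-elim (w∉D tt)
      dominating (inj₂ c) _   = inj₁ (own c) , tt , Adj-sym (spoke-Adj refl (λ ()))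

      member-off-e : ∀ c → Σ (Fin m) λ e₁ → Σ Bool λ s₁ → cls e₁ s₁ ≡ c × e₁ ≢ e
      member-off-e c with cls-onto c
      ... | e₁ , s₁ , refl with e₁ ≟ᶠ e
      ... | no e₁≢e = e₁ , s₁ , refl , e₁≢e
      ... | yes refl with s₁ ≟ᵇ s
      ... | yes refl = f , t , same-class , e≢f ∘ sym
      ... | no s₁≢s  = e′ , s′ , trans e′∈B (cong (cls e) (sym (¬-not s₁≢s))) , e′≢e

      total : TotalDominating deleted T′
      total (inj₁ w) with ¬Isolated⇒EdgeEnd (no-isolated w)
      ... | e₁ , s₁ , refl = inj₂ (cls e₁ s₁) , tt , spoke-Adj (cls-own e₁ s₁) (λ ())
      total (inj₂ c) with member-off-e c
      ... | e₁ , s₁ , refl , e₁≢e =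
        inj₂ (cls e₁ (not s₁)) , tt , subdivided-Adj (e₁≢e ∘ inj₂-injective) s₁

    IsDTDP-without-spoke : (∀ e′ s′ → cls e′ s′ ≡ B → e′ ≡ e) → IsDTDP (Without.deleted (inj₁ B))
    IsDTDP-without-spoke only-e = D , T′ , disjoint , dominating , total
      where
      open Without (inj₁ B)

      A≢B : A ≢ B
      A≢B A≡B = e≢f (sym (only-e f t (trans same-class A≡B)))

      outside-B : ∀ {e′ s′} → ¬ (e′ ≡ e × s′ ≡ not s) → cls e′ s′ ≢ B
      outside-B {e′} {s′} different e′∈B with only-e e′ s′ e′∈B
      ... | refl = different (refl , ¬-not λ { refl → A≢B e′∈B })

      D T′ : V G → Set
      D = [ (λ _ → ⊤) , (λ c → c ≡ B) ]
      T′ = [ (λ _ → ⊥) , (λ c → c ≢ B) ]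

      disjoint : ∀ x → D x → T′ x → ⊥
      disjoint (inj₂ _) c≡B c≢B = c≢B c≡B

      dominating : Dominating deleted D
      dominating (inj₁ _) w∉D = ⊥-elim (w∉D tt)
      dominating (inj₂ c) c≢B = inj₁ (own c) , tt , Adj-sym (spoke-Adj refl (c≢B ∘ inj₁-injective))

      total : TotalDominating deleted T′
      total (inj₁ w) with ¬Isolated⇒EdgeEnd (no-isolated w)
      ... | e₁ , s₁ , refl with (e₁ ≟ᶠ e) ×-dec (s₁ ≟ᵇ not s)
      ... | no different =
        inj₂ (cls e₁ s₁) , outside-B different ,
        spoke-Adj (cls-own e₁ s₁) (outside-B different ∘ inj₁-injective)
      ... | yes (refl , refl) =
        let (e₂ , s₂ , at-w , different) = ¬Pendant⇒anotherEdgeEnd e-not-pendant (not s)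
        in inj₂ (cls e₂ s₂) , outside-B different ,
           spoke-Adj (trans (cls-own e₂ s₂) at-w) (outside-B different ∘ inj₁-injective)
      total (inj₂ c) with c ≟ᶠ B
      ... | yes refl = inj₂ A , A≢B , Adj-sym (subdivided-Adj (λ ()) s)
      ... | no c≢B with cls-onto c
      ... | e₁ , s₁ , refl with (e₁ ≟ᶠ e) ×-dec (s₁ ≟ᵇ s)
      ... | no different =
        inj₂ (cls e₁ (not s₁)) , outside-B (different ∘ map₂ not-injective) , subdivided-Adj (λ ()) s₁
      ... | yes (refl , refl) =
        inj₂ (cls f (not t)) , outside-B (e≢f ∘ sym ∘ proj₁) ,
        subst (λ a → Adj deleted (inj₂ a) (inj₂ (cls f (not t)))) same-class (subdivided-Adj (λ ()) t)

    S₂P-ProperSpanningDTDP : ProperSpanningDTDP G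
    S₂P-ProperSpanningDTDP with anyEnd? (λ e′ s′ → (cls e′ s′ ≟ᶠ B) ×-dec ¬? (e′ ≟ᶠ e))
    ... | yes B-off-e =
      Without.IsDTDP-deleted⇒ProperSpanningDTDP (inj₂ e) (IsDTDP-without-middle-edge B-off-e)
    ... | no none =
      Without.IsDTDP-deleted⇒ProperSpanningDTDP (inj₁ B) (IsDTDP-without-spoke λ e′ s′ e′∈B →
        decidable-stable (e′ ≟ᶠ e) λ e′≢e → none (e′ , s′ , e′∈B , e′≢e))

proposition3p3 :
    (n m : ℕ) (ends : Fin m → Fin n × Fin n) →
    (∀ v → ¬ Isolated (FinGraph n m ends) v) →
    (K : ℕ) (own : Fin K → Fin n) (cls : Fin m → Bool → Fin K) →
    IsPartitionFamily ends K own cls →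
    (Σ (Fin n) λ v → Σ (Fin K) λ A → Σ (Fin m) λ e → Σ (Fin m) λ f →
       own A ≡ v × e ≢ f ×
       Incident (FinGraph n m ends) e v × Incident (FinGraph n m ends) f v ×
       (¬ Pendant (FinGraph n m ends) e ⊎ ¬ Pendant (FinGraph n m ends) f) ×
       (Σ Bool λ s → cls e s ≡ A) × (Σ Bool λ t → cls f t ≡ A)) →
    (IsDTDP (S₂P n m ends K own cls) × ¬ IsMinimalDTDP (S₂P n m ends K own cls)) ×
    ((θ : V (S₂P n m ends K own cls) → ℕ) → (∀ x → 1 ≤ θ x) →
       IsDTDP (expand (S₂P n m ends K own cls) θ) ×
       ¬ IsMinimalDTDP (expand (S₂P n m ends K own cls) θ))
proposition3p3 n m ends no-isolated K own cls partition
  (_ , _ , e , f , _ , e≢f , _ , _ , one-not-pendant , (s , e∈A) , (t , f∈A)) =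
  ProperSpanningDTDP⇒nonMinimalDTDP proper ,
  λ θ θ-pos → ProperSpanningDTDP⇒nonMinimalDTDP (expand-ProperSpanningDTDP θ-pos proper)
  where
  open S₂P-NonMinimal no-isolated partition

  proper : ProperSpanningDTDP (S₂P n m ends K own cls)
  proper = [ (λ e-not-pendant → S₂P-ProperSpanningDTDP e≢f e-not-pendant (trans f∈A (sym e∈A)))
           , (λ f-not-pendant → S₂P-ProperSpanningDTDP (e≢f ∘ sym) f-not-pendant (trans e∈A (sym f∈A)))
           ] one-not-pendant
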